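{- For all $n\ge 4$, $\lceil \lg(n+1)\rceil+1\le \det(FQ_n)\le \lceil \lg n\rceil+2$.
   Context: $\lg=\log_2$. The folded hypercube $FQ_n$ has vertex set $\mathbb{Z}_2^n$, two vertices being adjacent iff they differ in exactly one position or in all $n$ positions. A determining set is a vertex set such that the only automorphism fixing each of its vertices is the identity; $\det$ is the minimum size of a determining set. -}

module Defs where

open import Data.Nat using (ℕ; zero; suc; _+_; _≤_)
open import Data.Bool using (Bool; true; false; _xor_)
open import Data.Vec using (Vec; []; _∷_; zipWith; count)
open import Data.Bool using (T)
open import Data.Bool.Properties using (T?)
open import Data.List using (List; length)
open import Data.List.Membership.Propositional using (_∈_)
open import Data.List.Relation.Unary.Unique.Propositional using (Unique)
open import Data.Product using (_×_; Σ)
open import Data.Sum using (_⊎_)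
open import Function.Bundles using (_↔_; Inverse)
open import Relation.Binary.PropositionalEquality using (_≡_)

Vertex : ℕ → Set
Vertex n = Vec Bool n

hamming : ∀ {n} → Vertex n → Vertex n → ℕ
hamming u v = count T? (zipWith _xor_ u v)

FQAdj : ∀ n → Vertex n → Vertex n → Set
FQAdj n u v = hamming u v ≡ 1 ⊎ hamming u v ≡ n

record Automorphism (n : ℕ) : Set where
  field
    bij : Vertex n ↔ Vertex n
  open Inverse bij public using (to)
  field
    preserves : ∀ u v → (FQAdj n u v → FQAdj n (to u) (to v))
                      × (FQAdj n (to u) (to v) → FQAdj n u v)

IsDetermining : ∀ n → List (Vertex n) → Set
IsDetermining n S = (φ : Automorphism n)
  → (∀ x → x ∈ S → Automorphism.to φ x ≡ x)
  → ∀ v → Automorphism.to φ v ≡ v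

-- det(FQ_n) ≤ k : some determining set (no repeated vertices) has size ≤ k
DetAtMost : ℕ → ℕ → Set
DetAtMost n k = Σ (List (Vertex n)) λ S → Unique S × IsDetermining n S × length S ≤ k

-- k ≤ det(FQ_n) : every determining set has size ≥ k
DetAtLeast : ℕ → ℕ → Set
DetAtLeast n k = (S : List (Vertex n)) → Unique S → IsDetermining n S → k ≤ length S

-- FQ n is the Cayley graph of ℤ₂ⁿ with respect to the n + 1 generators 1ᵛ, e 0, …, e (n − 1).
--
-- Lower bound. For a linear functional f and a vector m with f m ≡ false, the transvection
-- v ↦ v ⊕ f(v)·m is a linear involution. With f = c p xor c q and m = g p ⊕ g q, where g are the
-- generators and c the matching coordinate functionals, it swaps g p and g q and fixes the other
-- generators; conjugated by the translation by a it is an automorphism fixing every x with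
-- f (a ⊕ x) ≡ false and moving a ⊕ g p. So if a ∷ D is determining, the n + 1 functionals
-- x ↦ c p (a ⊕ x) have pairwise different restrictions to D, whence n < 2 ^ |D|.
--
-- Upper bound. Vertices differing in d positions are at distance min d (n + 1 − d). Hence if s has
-- weight w ≥ 1 with 2w ≤ n, the unit vector e k is within distance w − 1 of s iff s has a 1 at k,
-- and 1ᵛ is not. An automorphism fixing 0ᵛ permutes its neighbours e k and 1ᵛ; if it also fixes e 0
-- and the ⌈lg n⌉ vectors listing the t-th binary digits of the positions (each of weight at most
-- n / 2), it therefore fixes every e k. For n ≥ 4 the only common neighbours of v ⊕ e i and v ⊕ e j
-- are v and v ⊕ e i ⊕ e j, so by induction on the weight every vertex is fixed.

module Submission where

open import Defs
open import Algebra.Bundles using (CommutativeSemigroup; CommutativeRing)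
import Algebra.Properties.CommutativeSemigroup as CommutativeSemigroupProperties
open import Data.Bool using (Bool; true; false; not; _xor_; if_then_else_)
import Data.Bool.Properties as 𝔹
open import Data.Fin as Fin using (Fin; zero; suc; combine; toℕ)
open import Data.Fin.Properties as Finₚ using (_≟_; 2↔Bool; combine-injective; pigeonhole; toℕ<n; toℕ-injective)
open import Data.List using (List; []; _∷_; length; applyUpTo; deduplicate)
open import Data.List.Membership.Propositional using (_∈_)
open import Data.List.Membership.Propositional.Properties using (∈-applyUpTo⁺; ∈-deduplicate⁺)
open import Data.List.Properties using (length-applyUpTo; length-deduplicate)
open import Data.List.Relation.Unary.All as All using (All; []; _∷_)
open import Data.List.Relation.Unary.Any using (here; there)
import Data.List.Relation.Unary.Unique.DecPropositional.Properties as UniqueDecProperties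
open import Data.Nat using (ℕ; zero; suc; _+_; _^_; _≤_; _<_; z≤n; s≤s; _≤?_; ⌊_/2⌋; ⌈_/2⌉)
open import Data.Nat.Logarithm using (⌈log₂_⌉; ⌈log₂⌉-mono-≤; ⌈log₂2^n⌉≡n; ⌈log₂⌈n/2⌉⌉≡⌈log₂n⌉∸1)
import Data.Nat.Properties as ℕ
open import Data.Nat.Tactic.RingSolver using (solve-∀)
open import Data.Product using (∃; ∃₂; _×_; _,_; proj₁; proj₂; uncurry)
open import Data.Sum using (_⊎_; inj₁; inj₂)
open import Data.Vec using ([]; _∷_; zipWith; replicate; lookup; count; tabulate)
open import Data.Vec.Properties
  using (lookup-zipWith; lookup-replicate; lookup∘tabulate; zipWith-assoc; zipWith-comm; zipWith-identityˡ;
         zipWith-identityʳ; zipWith-inverseʳ; map-id; count≤n; ∷-injectiveʳ; ≡-dec)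
open import Function using (_∘_)
open import Function.Bundles using (mk↔ₛ′; Inverse)
open import Level using (0ℓ)
open import Relation.Binary.PropositionalEquality
open import Relation.Nullary using (¬_; contradiction; yes; no)

private variable n : ℕ

-- The group ℤ₂ⁿ and the Hamming weight

infixl 6 _⊕_

_⊕_ : Vertex n → Vertex n → Vertex n
_⊕_ = zipWith _xor_

0ᵛ 1ᵛ : Vertex n
0ᵛ = replicate _ false
1ᵛ = replicate _ true

e : Fin n → Vertex n
e zero    = true ∷ 0ᵛ
e (suc i) = false ∷ e i

weight : Vertex n → ℕ
weight = count 𝔹.T?

⊕-assoc : ∀ (u v w : Vertex n) → (u ⊕ v) ⊕ w ≡ u ⊕ (v ⊕ w)
⊕-assoc = zipWith-assoc 𝔹.xor-assoc

⊕-comm : ∀ (u v : Vertex n) → u ⊕ v ≡ v ⊕ u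
⊕-comm = zipWith-comm 𝔹.xor-comm

⊕-identityˡ : ∀ (v : Vertex n) → 0ᵛ ⊕ v ≡ v
⊕-identityˡ = zipWith-identityˡ 𝔹.xor-identityˡ

⊕-identityʳ : ∀ (v : Vertex n) → v ⊕ 0ᵛ ≡ v
⊕-identityʳ = zipWith-identityʳ 𝔹.xor-identityʳ

⊕-self : ∀ (v : Vertex n) → v ⊕ v ≡ 0ᵛ
⊕-self v = trans (cong (v ⊕_) (sym (map-id v))) (zipWith-inverseʳ 𝔹.xor-same v)

⊕-commutativeSemigroup : ℕ → CommutativeSemigroup 0ℓ 0ℓ
⊕-commutativeSemigroup n = record
  { Carrier                = Vertex n
  ; _≈_                    = _≡_
  ; _∙_                    = _⊕_
  ; isCommutativeSemigroup = record
    { isSemigroup = record { isMagma = isMagma _⊕_ ; assoc = ⊕-assoc }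
    ; comm        = ⊕-comm
    }
  }

module ⊕-Properties (n : ℕ) = CommutativeSemigroupProperties (⊕-commutativeSemigroup n)

⊕-interchange : ∀ (a b c d : Vertex n) → (a ⊕ b) ⊕ (c ⊕ d) ≡ (a ⊕ c) ⊕ (b ⊕ d)
⊕-interchange {n} = ⊕-Properties.interchange n

⊕-swapʳ : ∀ (a b c : Vertex n) → (a ⊕ b) ⊕ c ≡ (a ⊕ c) ⊕ b
⊕-swapʳ {n} = ⊕-Properties.xy∙z≈xz∙y n

⊕-cancelˡ : ∀ (u v : Vertex n) → u ⊕ (u ⊕ v) ≡ v
⊕-cancelˡ u v = begin
  u ⊕ (u ⊕ v)  ≡⟨ ⊕-assoc u u v ⟨
  (u ⊕ u) ⊕ v  ≡⟨ cong (_⊕ v) (⊕-self u) ⟩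
  0ᵛ ⊕ v       ≡⟨ ⊕-identityˡ v ⟩
  v            ∎
  where open ≡-Reasoning

⊕-cancelʳ : ∀ (u v : Vertex n) → (u ⊕ v) ⊕ v ≡ u
⊕-cancelʳ u v = trans (⊕-comm (u ⊕ v) v) (trans (cong (v ⊕_) (⊕-comm u v)) (⊕-cancelˡ v u))

⊕-cancel-common : ∀ (a b c : Vertex n) → (a ⊕ b) ⊕ (a ⊕ c) ≡ b ⊕ c
⊕-cancel-common a b c = begin
  (a ⊕ b) ⊕ (a ⊕ c)  ≡⟨ ⊕-interchange a b a c ⟩
  (a ⊕ a) ⊕ (b ⊕ c)  ≡⟨ cong (_⊕ (b ⊕ c)) (⊕-self a) ⟩
  0ᵛ ⊕ (b ⊕ c)       ≡⟨ ⊕-identityˡ (b ⊕ c) ⟩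
  b ⊕ c              ∎
  where open ≡-Reasoning

⊕-injective : ∀ (a : Vertex n) {u v} → a ⊕ u ≡ a ⊕ v → u ≡ v
⊕-injective a {u} {v} eq = trans (sym (⊕-cancelˡ a u)) (trans (cong (a ⊕_) eq) (⊕-cancelˡ a v))

lookup-⊕ : ∀ (u v : Vertex n) i → lookup (u ⊕ v) i ≡ lookup u i xor lookup v i
lookup-⊕ u v i = lookup-zipWith _xor_ i u v

lookup-e-same : ∀ (i : Fin n) → lookup (e i) i ≡ true
lookup-e-same zero    = refl
lookup-e-same (suc i) = lookup-e-same i

lookup-e-other : ∀ {i j : Fin n} → i ≢ j → lookup (e i) j ≡ false
lookup-e-other {i = zero}  {zero}  i≢j = contradiction refl i≢j
lookup-e-other {i = zero}  {suc j} _   = lookup-replicate j false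
lookup-e-other {i = suc i} {zero}  _   = refl
lookup-e-other {i = suc i} {suc j} i≢j = lookup-e-other (i≢j ∘ cong suc)

lookup-⊕e-same : ∀ (v : Vertex n) i → lookup (v ⊕ e i) i ≡ not (lookup v i)
lookup-⊕e-same v i = trans (lookup-⊕ v (e i) i) (trans (cong (lookup v i xor_) (lookup-e-same i)) (𝔹.xor-comm _ true))

lookup-⊕e-other : ∀ (v : Vertex n) {i j} → i ≢ j → lookup (v ⊕ e i) j ≡ lookup v j
lookup-⊕e-other v {i} {j} i≢j =
  trans (lookup-⊕ v (e i) j) (trans (cong (lookup v j xor_) (lookup-e-other i≢j)) (𝔹.xor-identityʳ _))

e-injective : ∀ {i j : Fin n} → e i ≡ e j → i ≡ j
e-injective {i = zero}  {zero}  _  = refl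
e-injective {i = suc i} {suc j} eq = cong suc (e-injective (∷-injectiveʳ eq))

weight≡0⇒0ᵛ : ∀ (v : Vertex n) → weight v ≡ 0 → v ≡ 0ᵛ
weight≡0⇒0ᵛ []          _  = refl
weight≡0⇒0ᵛ (false ∷ v) eq = cong (false ∷_) (weight≡0⇒0ᵛ v eq)

weight≡0⇒lookup≡false : ∀ (v : Vertex n) → weight v ≡ 0 → ∀ i → lookup v i ≡ false
weight≡0⇒lookup≡false v w≡0 i = trans (cong (λ u → lookup u i) (weight≡0⇒0ᵛ v w≡0)) (lookup-replicate i false)

weight≡1⇒e : ∀ (v : Vertex n) → weight v ≡ 1 → ∃ λ i → v ≡ e i
weight≡1⇒e (true ∷ v)  eq = zero , cong (true ∷_) (weight≡0⇒0ᵛ v (ℕ.suc-injective eq))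
weight≡1⇒e (false ∷ v) eq with i , refl ← weight≡1⇒e v eq = suc i , refl

weight≡n⇒1ᵛ : ∀ (v : Vertex n) → weight v ≡ n → v ≡ 1ᵛ
weight≡n⇒1ᵛ []          _  = refl
weight≡n⇒1ᵛ (true ∷ v)  eq = cong (true ∷_) (weight≡n⇒1ᵛ v (ℕ.suc-injective eq))
weight≡n⇒1ᵛ (false ∷ v) eq = contradiction (count≤n 𝔹.T? v) (ℕ.<⇒≱ (ℕ.≤-reflexive (sym eq)))

weight-0ᵛ : weight (0ᵛ {n}) ≡ 0
weight-0ᵛ {zero}  = refl
weight-0ᵛ {suc n} = weight-0ᵛ {n}

weight-1ᵛ : weight (1ᵛ {n}) ≡ n
weight-1ᵛ {zero}  = refl
weight-1ᵛ {suc n} = cong suc (weight-1ᵛ {n})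

weight-e : ∀ (i : Fin n) → weight (e i) ≡ 1
weight-e {suc n} zero    = cong suc (weight-0ᵛ {n})
weight-e         (suc i) = weight-e i

weight-⊕1ᵛ : ∀ (v : Vertex n) → weight (v ⊕ 1ᵛ) + weight v ≡ n
weight-⊕1ᵛ []          = refl
weight-⊕1ᵛ (true ∷ v)  = trans (ℕ.+-suc _ _) (cong suc (weight-⊕1ᵛ v))
weight-⊕1ᵛ (false ∷ v) = cong suc (weight-⊕1ᵛ v)

weight-⊕e-true : ∀ (v : Vertex n) i → lookup v i ≡ true → suc (weight (v ⊕ e i)) ≡ weight v
weight-⊕e-true (true ∷ v)  zero    _  = cong suc (cong weight (⊕-identityʳ v))
weight-⊕e-true (true ∷ v)  (suc i) vᵢ = cong suc (weight-⊕e-true v i vᵢ)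
weight-⊕e-true (false ∷ v) (suc i) vᵢ = weight-⊕e-true v i vᵢ

weight-⊕e-pred : ∀ (v : Vertex n) i {w} → lookup v i ≡ true → weight v ≡ suc w → weight (v ⊕ e i) ≡ w
weight-⊕e-pred v i vᵢ weight≡1+w = ℕ.suc-injective (trans (weight-⊕e-true v i vᵢ) weight≡1+w)

weight-⊕e-false : ∀ (v : Vertex n) i → lookup v i ≡ false → weight (v ⊕ e i) ≡ suc (weight v)
weight-⊕e-false (false ∷ v) zero    _  = cong suc (cong weight (⊕-identityʳ v))
weight-⊕e-false (true ∷ v)  (suc i) vᵢ = cong suc (weight-⊕e-false v i vᵢ)
weight-⊕e-false (false ∷ v) (suc i) vᵢ = weight-⊕e-false v i vᵢ

weight>0⇒true : ∀ (v : Vertex n) {w} → weight v ≡ suc w → ∃ λ i → lookup v i ≡ true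
weight>0⇒true (true ∷ v)  _  = zero , refl
weight>0⇒true (false ∷ v) eq with i , vᵢ ← weight>0⇒true v eq = suc i , vᵢ

two-ones : ∀ (v : Vertex n) {w} → weight v ≡ suc (suc w) →
           ∃₂ λ i j → i ≢ j × lookup v i ≡ true × lookup v j ≡ true
two-ones v weight≡w+2
  with i , vᵢ ← weight>0⇒true v weight≡w+2
  with j , [v⊕eᵢ]ⱼ ← weight>0⇒true (v ⊕ e i) (weight-⊕e-pred v i vᵢ weight≡w+2) =
  i , j , i≢j , vᵢ , trans (sym (lookup-⊕e-other v i≢j)) [v⊕eᵢ]ⱼ
  where
  i≢j : i ≢ j
  i≢j refl = contradiction (trans (sym [v⊕eᵢ]ⱼ) (trans (lookup-⊕e-same v i) (cong not vᵢ))) λ ()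

-- Generators and adjacency

IsGenerator : Vertex n → Set
IsGenerator {n} d = weight d ≡ 1 ⊎ weight d ≡ n

generator : Fin (suc n) → Vertex n
generator zero    = 1ᵛ
generator (suc i) = e i

generator-isGenerator : ∀ (r : Fin (suc n)) → IsGenerator (generator r)
generator-isGenerator zero    = inj₂ weight-1ᵛ
generator-isGenerator (suc i) = inj₁ (weight-e i)

isGenerator⇒generator : ∀ (d : Vertex n) → IsGenerator d → ∃ λ r → d ≡ generator r
isGenerator⇒generator d (inj₁ w≡1) with i , d≡eᵢ ← weight≡1⇒e d w≡1 = suc i , d≡eᵢ
isGenerator⇒generator d (inj₂ w≡n) = zero , weight≡n⇒1ᵛ d w≡n

1ᵛ≢e : 2 ≤ n → ∀ (i : Fin n) → 1ᵛ ≢ e i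
1ᵛ≢e {n} 2≤n i 1ᵛ≡eᵢ = ℕ.<⇒≢ 2≤n (sym (begin
  n                ≡⟨ weight-1ᵛ ⟨
  weight (1ᵛ {n})  ≡⟨ cong weight 1ᵛ≡eᵢ ⟩
  weight (e i)     ≡⟨ weight-e i ⟩
  1                ∎))
  where open ≡-Reasoning

generator-injective : 2 ≤ n → ∀ {p q : Fin (suc n)} → generator p ≡ generator q → p ≡ q
generator-injective 2≤n {zero}  {zero}  _  = refl
generator-injective 2≤n {zero}  {suc j} eq = contradiction eq (1ᵛ≢e 2≤n j)
generator-injective 2≤n {suc i} {zero}  eq = contradiction (sym eq) (1ᵛ≢e 2≤n i)
generator-injective 2≤n {suc i} {suc j} eq = cong suc (e-injective eq)

adjacent-⊕ : ∀ (v g : Vertex n) → IsGenerator g → FQAdj n v (v ⊕ g)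
adjacent-⊕ v g = subst IsGenerator (sym (⊕-cancelˡ v g))

adjacent-⊕e : ∀ (v : Vertex n) i → FQAdj n v (v ⊕ e i)
adjacent-⊕e v i = adjacent-⊕ v (e i) (inj₁ (weight-e i))

adjacent⇒⊕generator : ∀ (u v : Vertex n) → FQAdj n u v → ∃ λ r → v ≡ u ⊕ generator r
adjacent⇒⊕generator u v adj with r , u⊕v≡gᵣ ← isGenerator⇒generator (u ⊕ v) adj =
  r , trans (sym (⊕-cancelˡ u v)) (cong (u ⊕_) u⊕v≡gᵣ)

-- Transvections and the lower bound

open CommutativeSemigroupProperties (CommutativeRing.+-commutativeSemigroup 𝔹.xor-∧-commutativeRing)
  using () renaming (interchange to xor-interchange)

-- The zero functional is paired with the generator 1ᵛ, so that coordinate p (generator r)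
-- depends only on whether p ≡ r.
coordinate : Fin (suc n) → Vertex n → Bool
coordinate zero    _ = false
coordinate (suc i) v = lookup v i

coordinate-⊕ : ∀ (p : Fin (suc n)) u v → coordinate p (u ⊕ v) ≡ coordinate p u xor coordinate p v
coordinate-⊕ zero    u v = refl
coordinate-⊕ (suc i) u v = lookup-⊕ u v i

coordinate-generator-≢ : ∀ {p r : Fin (suc n)} → p ≢ r →
                         coordinate p (generator r) ≡ not (coordinate r (generator r))
coordinate-generator-≢ {p = zero}  {zero}  p≢r = contradiction refl p≢r
coordinate-generator-≢ {p = zero}  {suc k} _   = cong not (sym (lookup-e-same k))
coordinate-generator-≢ {p = suc i} {zero}  _   = lookup-replicate i true
coordinate-generator-≢ {p = suc i} {suc k} p≢r =
  trans (lookup-e-other (p≢r ∘ cong suc ∘ sym)) (cong not (sym (lookup-e-same k)))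

module Transvection (f : Vertex n → Bool) (f-⊕ : ∀ u v → f (u ⊕ v) ≡ f u xor f v)
                    (m : Vertex n) (f-m : f m ≡ false) where

  shift : Bool → Vertex n
  shift b = if b then m else 0ᵛ

  τ : Vertex n → Vertex n
  τ v = v ⊕ shift (f v)

  f-0ᵛ : f 0ᵛ ≡ false
  f-0ᵛ = begin
    f 0ᵛ               ≡⟨ cong f (⊕-self 0ᵛ) ⟨
    f (0ᵛ ⊕ 0ᵛ)        ≡⟨ f-⊕ 0ᵛ 0ᵛ ⟩
    f 0ᵛ xor f 0ᵛ      ≡⟨ 𝔹.xor-same (f 0ᵛ) ⟩
    false              ∎
    where open ≡-Reasoning

  f-shift : ∀ b → f (shift b) ≡ false
  f-shift true  = f-m
  f-shift false = f-0ᵛ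

  shift-xor : ∀ a b → shift (a xor b) ≡ shift a ⊕ shift b
  shift-xor true  true  = sym (⊕-self m)
  shift-xor true  false = sym (⊕-identityʳ m)
  shift-xor false _     = sym (⊕-identityˡ _)

  τ-⊕ : ∀ u v → τ (u ⊕ v) ≡ τ u ⊕ τ v
  τ-⊕ u v = begin
    (u ⊕ v) ⊕ shift (f (u ⊕ v))             ≡⟨ cong (λ b → (u ⊕ v) ⊕ shift b) (f-⊕ u v) ⟩
    (u ⊕ v) ⊕ shift (f u xor f v)           ≡⟨ cong ((u ⊕ v) ⊕_) (shift-xor (f u) (f v)) ⟩
    (u ⊕ v) ⊕ (shift (f u) ⊕ shift (f v))   ≡⟨ ⊕-interchange u v _ _ ⟩
    τ u ⊕ τ v                               ∎
    where open ≡-Reasoning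

  f-τ : ∀ v → f (τ v) ≡ f v
  f-τ v = begin
    f (v ⊕ shift (f v))        ≡⟨ f-⊕ v _ ⟩
    f v xor f (shift (f v))    ≡⟨ cong (f v xor_) (f-shift (f v)) ⟩
    f v xor false              ≡⟨ 𝔹.xor-identityʳ (f v) ⟩
    f v                        ∎
    where open ≡-Reasoning

  τ-involutive : ∀ v → τ (τ v) ≡ v
  τ-involutive v = trans (cong (λ b → τ v ⊕ shift b) (f-τ v)) (⊕-cancelʳ v _)

  τ-fixes : ∀ v → f v ≡ false → τ v ≡ v
  τ-fixes v fv≡false = trans (cong (λ b → v ⊕ shift b) fv≡false) (⊕-identityʳ v)

  τ-moves : ∀ v → f v ≡ true → τ v ≡ v ⊕ m
  τ-moves v fv≡true = cong (λ b → v ⊕ shift b) fv≡true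

  centred : Vertex n → Vertex n → Vertex n
  centred a v = a ⊕ τ (a ⊕ v)

  centred-involutive : ∀ a v → centred a (centred a v) ≡ v
  centred-involutive a v = begin
    a ⊕ τ (a ⊕ (a ⊕ τ (a ⊕ v)))  ≡⟨ cong (λ w → a ⊕ τ w) (⊕-cancelˡ a _) ⟩
    a ⊕ τ (τ (a ⊕ v))            ≡⟨ cong (a ⊕_) (τ-involutive (a ⊕ v)) ⟩
    a ⊕ (a ⊕ v)                  ≡⟨ ⊕-cancelˡ a v ⟩
    v                            ∎
    where open ≡-Reasoning

  centred-⊕ : ∀ a u v → centred a u ⊕ centred a v ≡ τ (u ⊕ v)
  centred-⊕ a u v = begin
    (a ⊕ τ (a ⊕ u)) ⊕ (a ⊕ τ (a ⊕ v))  ≡⟨ ⊕-cancel-common a _ _ ⟩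
    τ (a ⊕ u) ⊕ τ (a ⊕ v)              ≡⟨ τ-⊕ (a ⊕ u) (a ⊕ v) ⟨
    τ ((a ⊕ u) ⊕ (a ⊕ v))              ≡⟨ cong τ (⊕-cancel-common a u v) ⟩
    τ (u ⊕ v)                          ∎
    where open ≡-Reasoning

  centred-fixes : ∀ a x → f (a ⊕ x) ≡ false → centred a x ≡ x
  centred-fixes a x eq = trans (cong (a ⊕_) (τ-fixes (a ⊕ x) eq)) (⊕-cancelˡ a x)

  centredAutomorphism : (∀ d → IsGenerator d → IsGenerator (τ d)) → Vertex n → Automorphism n
  centredAutomorphism τ-generator a = record
    { bij       = mk↔ₛ′ (centred a) (centred a) (centred-involutive a) (centred-involutive a)
    ; preserves = λ u v →
        subst IsGenerator (sym (centred-⊕ a u v)) ∘ τ-generator (u ⊕ v) ,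
        τ-generator⁻ (u ⊕ v) ∘ subst IsGenerator (centred-⊕ a u v)
    }
    where
    τ-generator⁻ : ∀ d → IsGenerator (τ d) → IsGenerator d
    τ-generator⁻ d = subst IsGenerator (τ-involutive d) ∘ τ-generator (τ d)

module SwapGenerators {p q : Fin (suc n)} (p≢q : p ≢ q) where

  swapFunctional : Vertex n → Bool
  swapFunctional v = coordinate p v xor coordinate q v

  swapFunctional-⊕ : ∀ u v → swapFunctional (u ⊕ v) ≡ swapFunctional u xor swapFunctional v
  swapFunctional-⊕ u v = trans (cong₂ _xor_ (coordinate-⊕ p u v) (coordinate-⊕ q u v))
                               (xor-interchange (coordinate p u) (coordinate p v) (coordinate q u) (coordinate q v))

  swapFunctional-p : swapFunctional (generator p) ≡ true
  swapFunctional-p = trans (cong (coordinate p (generator p) xor_) (coordinate-generator-≢ (p≢q ∘ sym)))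
                           (𝔹.xor-inverseʳ (coordinate p (generator p)))

  swapFunctional-q : swapFunctional (generator q) ≡ true
  swapFunctional-q = trans (cong (_xor coordinate q (generator q)) (coordinate-generator-≢ p≢q))
                           (𝔹.xor-inverseˡ (coordinate q (generator q)))

  swapFunctional-other : ∀ {r} → p ≢ r → q ≢ r → swapFunctional (generator r) ≡ false
  swapFunctional-other {r} p≢r q≢r =
    trans (cong₂ _xor_ (coordinate-generator-≢ p≢r) (coordinate-generator-≢ q≢r))
          (𝔹.xor-same (not (coordinate r (generator r))))

  open Transvection swapFunctional swapFunctional-⊕ (generator p ⊕ generator q)
    (trans (swapFunctional-⊕ (generator p) (generator q)) (cong₂ _xor_ swapFunctional-p swapFunctional-q))
    public

  τ-generator-p : τ (generator p) ≡ generator q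
  τ-generator-p = trans (τ-moves _ swapFunctional-p) (⊕-cancelˡ (generator p) (generator q))

  τ-generator-q : τ (generator q) ≡ generator p
  τ-generator-q = begin
    τ (generator q)                            ≡⟨ τ-moves _ swapFunctional-q ⟩
    generator q ⊕ (generator p ⊕ generator q)  ≡⟨ ⊕-comm _ _ ⟩
    (generator p ⊕ generator q) ⊕ generator q  ≡⟨ ⊕-cancelʳ _ _ ⟩
    generator p                                ∎
    where open ≡-Reasoning

  τ-generator : ∀ d → IsGenerator d → IsGenerator (τ d)
  τ-generator d d-gen with r , refl ← isGenerator⇒generator d d-gen | p ≟ r | q ≟ r
  ... | yes refl | _        = subst IsGenerator (sym τ-generator-p) (generator-isGenerator q)
  ... | no _     | yes refl = subst IsGenerator (sym τ-generator-q) (generator-isGenerator p)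
  ... | no p≢r   | no q≢r   =
    subst IsGenerator (sym (τ-fixes _ (swapFunctional-other p≢r q≢r))) (generator-isGenerator r)

profile : ∀ {A : Set} → (A → Bool) → (xs : List A) → Fin (2 ^ length xs)
profile f []       = zero
profile f (x ∷ xs) = combine (Inverse.from 2↔Bool (f x)) (profile f xs)

profile-injective : ∀ {A : Set} {f g : A → Bool} xs → profile f xs ≡ profile g xs →
                    All (λ x → f x ≡ g x) xs
profile-injective []       _  = []
profile-injective {f = f} {g} (x ∷ xs) eq with fx≡gx , rest ← combine-injective _ _ _ _ eq =
  from-injective fx≡gx ∷ profile-injective xs rest
  where
  from-injective : ∀ {b c} → Inverse.from 2↔Bool b ≡ Inverse.from 2↔Bool c → b ≡ c
  from-injective {b} {c} eq = begin
    b                                            ≡⟨ Inverse.strictlyInverseˡ 2↔Bool b ⟨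
    Inverse.to 2↔Bool (Inverse.from 2↔Bool b)   ≡⟨ cong (Inverse.to 2↔Bool) eq ⟩
    Inverse.to 2↔Bool (Inverse.from 2↔Bool c)   ≡⟨ Inverse.strictlyInverseˡ 2↔Bool c ⟩
    c                                            ∎
    where open ≡-Reasoning

profiles-collide : ∀ {A : Set} {m} (xs : List A) (f : Fin m → A → Bool) → 2 ^ length xs < m →
                   ∃₂ λ p q → p Fin.< q × All (λ x → f p x ≡ f q x) xs
profiles-collide xs f 2^|xs|<m with p , q , p<q , eq ← pigeonhole 2^|xs|<m (λ p → profile (f p) xs) =
  p , q , p<q , profile-injective xs eq

determining⇒n<2^|D| : 2 ≤ n → ∀ a D → IsDetermining n (a ∷ D) → n < 2 ^ length D
determining⇒n<2^|D| {n} 2≤n a D determining with suc n ≤? 2 ^ length D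
... | yes n<2^|D| = n<2^|D|
... | no  n≮2^|D|
  with p , q , p<q , agree ← profiles-collide D (λ p x → coordinate p (a ⊕ x)) (ℕ.≰⇒> n≮2^|D|) =
  contradiction (generator-injective 2≤n generator-p≡q) (Finₚ.<⇒≢ p<q)
  where
  open SwapGenerators (Finₚ.<⇒≢ p<q)

  fixes : ∀ x → x ∈ a ∷ D → centred a x ≡ x
  fixes x (here refl)  = centred-fixes a a (trans (cong swapFunctional (⊕-self a)) f-0ᵛ)
  fixes x (there x∈D) = centred-fixes a x
    (trans (cong (_xor coordinate q (a ⊕ x)) (All.lookup agree x∈D)) (𝔹.xor-same (coordinate q (a ⊕ x))))

  generator-p≡q : generator p ≡ generator q
  generator-p≡q = ⊕-injective a (sym (begin
    a ⊕ generator q                    ≡⟨ cong (a ⊕_) τ-generator-p ⟨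
    a ⊕ τ (generator p)                ≡⟨ cong (λ w → a ⊕ τ w) (⊕-cancelˡ a _) ⟨
    centred a (a ⊕ generator p)        ≡⟨ determining (centredAutomorphism τ-generator a) fixes _ ⟩
    a ⊕ generator p                    ∎))
    where open ≡-Reasoning

⌈log₂⌉-≤ : ∀ {m} k → m ≤ 2 ^ k → ⌈log₂ m ⌉ ≤ k
⌈log₂⌉-≤ {m} k m≤2^k = subst (⌈log₂ m ⌉ ≤_) (⌈log₂2^n⌉≡n k) (⌈log₂⌉-mono-≤ m≤2^k)

det-lowerBound : 2 ≤ n → DetAtLeast n (⌈log₂ (n + 1) ⌉ + 1)
det-lowerBound 2≤n []      _ determining =
  contradiction (ℕ.≤-trans 2≤n (ℕ.≤-pred (determining⇒n<2^|D| 2≤n 0ᵛ [] (λ φ _ → determining φ λ _ ())))) λ ()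
det-lowerBound {n} 2≤n (a ∷ D) _ determining = begin
  ⌈log₂ (n + 1) ⌉ + 1  ≡⟨ cong (λ m → ⌈log₂ m ⌉ + 1) (ℕ.+-comm n 1) ⟩
  ⌈log₂ suc n ⌉ + 1    ≡⟨ ℕ.+-comm _ 1 ⟩
  suc ⌈log₂ suc n ⌉    ≤⟨ s≤s (⌈log₂⌉-≤ (length D) (determining⇒n<2^|D| 2≤n a D determining)) ⟩
  suc (length D)       ∎
  where open ℕ.≤-Reasoning

-- Walks and distances

⊕-through : ∀ (x y z : Vertex n) → (x ⊕ y) ⊕ (y ⊕ z) ≡ x ⊕ z
⊕-through x y z = begin
  (x ⊕ y) ⊕ (y ⊕ z)  ≡⟨ ⊕-assoc x y (y ⊕ z) ⟩
  x ⊕ (y ⊕ (y ⊕ z))  ≡⟨ cong (x ⊕_) (⊕-cancelˡ y z) ⟩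
  x ⊕ z              ∎
  where open ≡-Reasoning

weight-⊕e-≤ : ∀ (v : Vertex n) i → weight (v ⊕ e i) ≤ suc (weight v) × weight v ≤ suc (weight (v ⊕ e i))
weight-⊕e-≤ v i with lookup v i in vᵢ
... | true  = ℕ.m≤n⇒m≤1+n (ℕ.≤-trans (ℕ.n≤1+n (weight (v ⊕ e i))) (ℕ.≤-reflexive eq)) , ℕ.≤-reflexive (sym eq)
  where
  eq : suc (weight (v ⊕ e i)) ≡ weight v
  eq = weight-⊕e-true v i vᵢ
... | false = ℕ.≤-reflexive eq , ℕ.m≤n⇒m≤1+n (ℕ.≤-trans (ℕ.n≤1+n (weight v)) (ℕ.≤-reflexive (sym eq)))
  where
  eq : weight (v ⊕ e i) ≡ suc (weight v)
  eq = weight-⊕e-false v i vᵢ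

data WalkWithin {n} : ℕ → Vertex n → Vertex n → Set where
  done : ∀ {m x} → WalkWithin m x x
  step : ∀ {m x y z} → FQAdj n x y → WalkWithin m y z → WalkWithin (suc m) x z

walk-of-weight : ∀ d (x y : Vertex n) → weight (x ⊕ y) ≡ d → WalkWithin d x y
walk-of-weight zero    x y w≡0 =
  subst (WalkWithin 0 x) (⊕-injective x (trans (⊕-self x) (sym (weight≡0⇒0ᵛ (x ⊕ y) w≡0)))) done
walk-of-weight (suc d) x y w≡d+1 with i , [x⊕y]ᵢ ← weight>0⇒true (x ⊕ y) w≡d+1 =
  step (adjacent-⊕e x i) (walk-of-weight d (x ⊕ e i) y (begin
    weight ((x ⊕ e i) ⊕ y)  ≡⟨ cong weight (⊕-swapʳ x (e i) y) ⟩
    weight ((x ⊕ y) ⊕ e i)  ≡⟨ weight-⊕e-pred (x ⊕ y) i [x⊕y]ᵢ w≡d+1 ⟩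
    d                       ∎))
  where open ≡-Reasoning

-- min w (n + 1 − w) ≤ m, without truncated subtraction: vertices differing in w positions are
-- at distance min w (n + 1 − w) in FQ_n.
FoldedWeight≤ : ℕ → ℕ → ℕ → Set
FoldedWeight≤ n w m = w ≤ m ⊎ suc n ≤ w + m

foldedWeight≤-unit : ∀ {w w′ m} → w′ ≤ suc w → w ≤ suc w′ →
                     FoldedWeight≤ n w m → FoldedWeight≤ n w′ (suc m)
foldedWeight≤-unit w′≤1+w _ (inj₁ w≤m) = inj₁ (ℕ.≤-trans w′≤1+w (s≤s w≤m))
foldedWeight≤-unit {w′ = w′} {m} _ w≤1+w′ (inj₂ n<w+m) =
  inj₂ (ℕ.≤-trans n<w+m (ℕ.≤-trans (ℕ.+-monoˡ-≤ m w≤1+w′) (ℕ.≤-reflexive (sym (ℕ.+-suc w′ m)))))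

foldedWeight≤-antipode : ∀ {w w′ m} → w′ + w ≡ n →
                         FoldedWeight≤ n w m → FoldedWeight≤ n w′ (suc m)
foldedWeight≤-antipode {w′ = w′} {m} w′+w≡n (inj₁ w≤m) =
  inj₂ (subst (λ k → suc k ≤ w′ + suc m) w′+w≡n
         (ℕ.≤-trans (ℕ.≤-reflexive (sym (ℕ.+-suc w′ _))) (ℕ.+-monoʳ-≤ w′ (s≤s w≤m))))
foldedWeight≤-antipode {w = w} {w′} {m} w′+w≡n (inj₂ n<w+m) =
  inj₁ (ℕ.m≤n⇒m≤1+n (ℕ.<⇒≤ (ℕ.+-cancelʳ-≤ w (suc w′) m
    (subst (λ k → suc k ≤ m + w) (sym w′+w≡n) (ℕ.≤-trans n<w+m (ℕ.≤-reflexive (ℕ.+-comm w m)))))))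

foldedWeight≤-⊕generator : ∀ r (u v : Vertex n) {m} → u ≡ v ⊕ generator r →
                           FoldedWeight≤ n (weight v) m → FoldedWeight≤ n (weight u) (suc m)
foldedWeight≤-⊕generator zero    u v refl = foldedWeight≤-antipode (weight-⊕1ᵛ v)
foldedWeight≤-⊕generator (suc k) u v refl = uncurry foldedWeight≤-unit (weight-⊕e-≤ v k)

walk⇒foldedWeight≤ : ∀ {m} {x y : Vertex n} → WalkWithin m x y → FoldedWeight≤ n (weight (x ⊕ y)) m
walk⇒foldedWeight≤ {n} {x = x} done =
  inj₁ (subst (_≤ _) (sym (trans (cong weight (⊕-self x)) (weight-0ᵛ {n}))) z≤n)
walk⇒foldedWeight≤ {x = x} {z} (step {y = y} x~y walk)
  with r , x⊕y≡gᵣ ← isGenerator⇒generator (x ⊕ y) x~y =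
  foldedWeight≤-⊕generator r (x ⊕ z) (y ⊕ z) x⊕z (walk⇒foldedWeight≤ walk)
  where
  x⊕z : x ⊕ z ≡ (y ⊕ z) ⊕ generator r
  x⊕z = begin
    x ⊕ z                      ≡⟨ ⊕-through x y z ⟨
    (x ⊕ y) ⊕ (y ⊕ z)          ≡⟨ ⊕-comm _ _ ⟩
    (y ⊕ z) ⊕ (x ⊕ y)          ≡⟨ cong ((y ⊕ z) ⊕_) x⊕y≡gᵣ ⟩
    (y ⊕ z) ⊕ generator r      ∎
    where open ≡-Reasoning

¬foldedWeight≤-far : ∀ {r} → suc r + suc r ≤ n → ¬ FoldedWeight≤ n (suc (suc r)) r
¬foldedWeight≤-far _ (inj₁ r+2≤r) = ℕ.<⇒≱ (ℕ.n<1+n _) (ℕ.≤-pred (ℕ.m≤n⇒m≤1+n r+2≤r))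
¬foldedWeight≤-far {r = r} 2r+2≤n (inj₂ n<r+2+r) =
  ℕ.<⇒≱ (ℕ.≤-trans (s≤s 2r+2≤n) n<r+2+r) (ℕ.≤-reflexive (cong suc (sym (ℕ.+-suc r r))))

¬foldedWeight≤-antipodal : ∀ {c r} → c + suc r ≡ n → suc r + suc r ≤ n → ¬ FoldedWeight≤ n c r
¬foldedWeight≤-antipodal {c = c} {r} c+r+1≡n 2r+2≤n (inj₁ c≤r) =
  ℕ.<⇒≱ 2r+2≤n (ℕ.≤-trans (ℕ.≤-reflexive (sym c+r+1≡n)) (ℕ.+-monoˡ-≤ (suc r) c≤r))
¬foldedWeight≤-antipodal {c = c} {r} c+r+1≡n _ (inj₂ n<c+r) =
  ℕ.<⇒≱ n<c+r (ℕ.≤-trans (ℕ.+-monoʳ-≤ c (ℕ.n≤1+n r)) (ℕ.≤-reflexive c+r+1≡n))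

automorphism-walk : ∀ (φ : Automorphism n) {m x y} → WalkWithin m x y →
                    WalkWithin m (Automorphism.to φ x) (Automorphism.to φ y)
automorphism-walk φ done                      = done
automorphism-walk φ (step {x = x} {y} x~y w) =
  step (proj₁ (Automorphism.preserves φ x y) x~y) (automorphism-walk φ w)

automorphism-walk⁻ : ∀ (φ : Automorphism n) {m x y} →
                     WalkWithin m (Automorphism.to φ x) (Automorphism.to φ y) → WalkWithin m x y
automorphism-walk⁻ φ {m} {x} {y} w =
  subst₂ (WalkWithin m) (strictlyInverseʳ x) (strictlyInverseʳ y) (pullBack w)
  where
  open Inverse (Automorphism.bij φ)
  pullBack : ∀ {m u v} → WalkWithin m u v → WalkWithin m (from u) (from v)
  pullBack done                      = done
  pullBack (step {x = u} {v} u~v w) = step (proj₂ (Automorphism.preserves φ (from u) (from v))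
    (subst₂ (FQAdj _) (sym (strictlyInverseˡ u)) (sym (strictlyInverseˡ v)) u~v)) (pullBack w)

-- Automorphisms fixing 0ᵛ

Light : Vertex n → Set
Light {n} s = weight s + weight s ≤ n

module _ {s : Vertex n} {r} (weight≡1+r : weight s ≡ suc r) where

  light⇒2r+2≤n : Light s → suc r + suc r ≤ n
  light⇒2r+2≤n = subst (λ w → w + w ≤ n) weight≡1+r

  near-e : ∀ {k} → lookup s k ≡ true → WalkWithin r s (e k)
  near-e {k} sₖ = walk-of-weight r s (e k) (weight-⊕e-pred s k sₖ weight≡1+r)

  near-e⁻ : ∀ {k} → Light s → WalkWithin r s (e k) → lookup s k ≡ true
  near-e⁻ {k} light walk with lookup s k in sₖ
  ... | true  = refl
  ... | false = contradiction
    (subst (λ w → FoldedWeight≤ n w r) (trans (weight-⊕e-false s k sₖ) (cong suc weight≡1+r))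
           (walk⇒foldedWeight≤ walk))
    (¬foldedWeight≤-far (light⇒2r+2≤n light))

  ¬near-1ᵛ : Light s → ¬ WalkWithin r s 1ᵛ
  ¬near-1ᵛ light walk = ¬foldedWeight≤-antipodal
    (subst (λ w → weight (s ⊕ 1ᵛ) + w ≡ n) weight≡1+r (weight-⊕1ᵛ s)) (light⇒2r+2≤n light)
    (walk⇒foldedWeight≤ walk)

module FixedProbe (φ : Automorphism n) {s : Vertex n} (φs≡s : Automorphism.to φ s ≡ s) (light : Light s) where
  open Automorphism φ using (to)

  fixed-walk : ∀ {r x} → WalkWithin r s x → WalkWithin r s (to x)
  fixed-walk walk = subst (λ u → WalkWithin _ u _) φs≡s (automorphism-walk φ walk)

  fixed-walk⁻ : ∀ {r x} → WalkWithin r s (to x) → WalkWithin r s x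
  fixed-walk⁻ walk = automorphism-walk⁻ φ (subst (λ u → WalkWithin _ u _) (sym φs≡s) walk)

  probe-agrees : ∀ {k j} → to (e k) ≡ e j → lookup s k ≡ lookup s j
  probe-agrees {k} {j} φeₖ≡eⱼ = byWeight (weight s) refl
    where
    true-iff⇒≡ : ∀ {a b} → (a ≡ true → b ≡ true) → (b ≡ true → a ≡ true) → a ≡ b
    true-iff⇒≡ {false} {false} _ _   = refl
    true-iff⇒≡ {false} {true}  _ b⇒a = b⇒a refl
    true-iff⇒≡ {true}          a⇒b _ = sym (a⇒b refl)

    byWeight : ∀ w → weight s ≡ w → lookup s k ≡ lookup s j
    byWeight zero    w≡0   = trans (weight≡0⇒lookup≡false s w≡0 k) (sym (weight≡0⇒lookup≡false s w≡0 j))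
    byWeight (suc r) w≡1+r = true-iff⇒≡
      (λ sₖ → near-e⁻ w≡1+r light (subst (WalkWithin r s) φeₖ≡eⱼ (fixed-walk (near-e w≡1+r sₖ))))
      (λ sⱼ → near-e⁻ w≡1+r light (fixed-walk⁻ (subst (WalkWithin r s) (sym φeₖ≡eⱼ) (near-e w≡1+r sⱼ))))

  probe-avoids-1ᵛ : ∀ {k} → to (e k) ≡ 1ᵛ → lookup s k ≡ false
  probe-avoids-1ᵛ {k} φeₖ≡1ᵛ with lookup s k in sₖ
  ... | false = refl
  ... | true  = byWeight (weight s) refl
    where
    byWeight : ∀ w → weight s ≡ w → true ≡ false
    byWeight zero    w≡0   = trans (sym sₖ) (weight≡0⇒lookup≡false s w≡0 k)
    byWeight (suc r) w≡1+r =
      contradiction (subst (WalkWithin r s) φeₖ≡1ᵛ (fixed-walk (near-e w≡1+r sₖ))) (¬near-1ᵛ w≡1+r light)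

module _ (φ : Automorphism n) (φ0≡0 : Automorphism.to φ 0ᵛ ≡ 0ᵛ) where
  open Automorphism φ using (to; preserves)

  0~φe : ∀ k → FQAdj n 0ᵛ (to (e k))
  0~φe k = subst (λ u → FQAdj n u (to (e k))) φ0≡0
    (proj₁ (preserves 0ᵛ (e k)) (subst (FQAdj n 0ᵛ) (⊕-identityˡ (e k)) (adjacent-⊕e 0ᵛ k)))

  image-e : ∀ k → ∃ λ r → to (e k) ≡ generator r
  image-e k with r , φeₖ≡0⊕gᵣ ← adjacent⇒⊕generator 0ᵛ (to (e k)) (0~φe k) =
    r , trans φeₖ≡0⊕gᵣ (⊕-identityˡ (generator r))

  fixes-units : (∀ {k j} → k ≢ j → ∃ λ s → to s ≡ s × Light s × lookup s k ≢ lookup s j) →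
                (∀ k → ∃ λ s → to s ≡ s × Light s × lookup s k ≡ true) →
                ∀ k → to (e k) ≡ e k
  fixes-units separating covering k with image-e k
  ... | zero , φeₖ≡1ᵛ
    with s , φs≡s , light , sₖ ← covering k =
    contradiction (trans (sym sₖ) (FixedProbe.probe-avoids-1ᵛ φ φs≡s light φeₖ≡1ᵛ)) λ ()
  ... | suc j , φeₖ≡eⱼ with k ≟ j
  ...   | yes refl = φeₖ≡eⱼ
  ...   | no k≢j
    with s , φs≡s , light , sₖ≢sⱼ ← separating k≢j =
    contradiction (FixedProbe.probe-agrees φ φs≡s light φeₖ≡eⱼ) sₖ≢sⱼ

weight-e⊕e : ∀ {i j : Fin n} → i ≢ j → weight (e i ⊕ e j) ≡ 2
weight-e⊕e {i = i} {j} i≢j = trans (weight-⊕e-false (e i) j (lookup-e-other i≢j)) (cong suc (weight-e i))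

e⊕e≢e⊕1ᵛ : 4 ≤ n → ∀ {i j k : Fin n} → i ≢ j → e i ⊕ e j ≢ e k ⊕ 1ᵛ
e⊕e≢e⊕1ᵛ {n} 4≤n {i} {j} {k} i≢j eq = ℕ.<⇒≢ 4≤n (begin
  3                            ≡⟨ cong (_+ 1) (weight-e⊕e i≢j) ⟨
  weight (e i ⊕ e j) + 1       ≡⟨ cong₂ _+_ (cong weight (sym eq)) (weight-e k) ⟨
  weight (e k ⊕ 1ᵛ) + weight (e k)   ≡⟨ weight-⊕1ᵛ (e k) ⟩
  n                            ∎)
  where open ≡-Reasoning

generator-pair : 4 ≤ n → ∀ {i j : Fin n} → i ≢ j → ∀ r r′ →
                 generator r ⊕ generator r′ ≡ e i ⊕ e j → generator r ≡ e i ⊎ generator r ≡ e j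
generator-pair 4≤n {i} {j} i≢j zero zero eq =
  contradiction (e-injective (⊕-injective (e i) (trans (⊕-self (e i)) (trans (sym (⊕-self 1ᵛ)) eq)))) i≢j
generator-pair 4≤n i≢j zero (suc l) eq = contradiction (sym (trans (⊕-comm (e l) 1ᵛ) eq)) (e⊕e≢e⊕1ᵛ 4≤n i≢j)
generator-pair 4≤n i≢j (suc k) zero eq = contradiction (sym eq) (e⊕e≢e⊕1ᵛ 4≤n i≢j)
generator-pair 4≤n {i} {j} i≢j (suc k) (suc l) eq with k ≟ i | l ≟ i
... | yes refl | _        = inj₁ refl
... | no _     | yes refl = inj₂ (⊕-injective (e l) (trans (⊕-comm (e l) (e k)) eq))
... | no k≢i   | no l≢i   = contradiction (begin
  true                                 ≡⟨ cong₂ _xor_ (lookup-e-same i) (lookup-e-other (i≢j ∘ sym)) ⟨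
  lookup (e i) i xor lookup (e j) i    ≡⟨ lookup-⊕ (e i) (e j) i ⟨
  lookup (e i ⊕ e j) i                 ≡⟨ cong (λ v → lookup v i) eq ⟨
  lookup (e k ⊕ e l) i                 ≡⟨ lookup-⊕ (e k) (e l) i ⟩
  lookup (e k) i xor lookup (e l) i    ≡⟨ cong₂ _xor_ (lookup-e-other k≢i) (lookup-e-other l≢i) ⟩
  false                                ∎) λ ()
  where open ≡-Reasoning

common-neighbours : 4 ≤ n → ∀ {i j : Fin n} → i ≢ j → ∀ {x y} →
                    FQAdj n y (x ⊕ e i) → FQAdj n y (x ⊕ e j) → y ≡ x ⊎ y ≡ (x ⊕ e i) ⊕ e j
common-neighbours 4≤n {i} {j} i≢j {x} {y} y~xeᵢ y~xeⱼ
  with r , g≡gᵣ ← isGenerator⇒generator _ y~xeᵢ | r′ , h≡gᵣ′ ← isGenerator⇒generator _ y~xeⱼ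
  with generator-pair 4≤n i≢j r r′ (begin
    generator r ⊕ generator r′                ≡⟨ cong₂ _⊕_ g≡gᵣ h≡gᵣ′ ⟨
    (y ⊕ (x ⊕ e i)) ⊕ (y ⊕ (x ⊕ e j))         ≡⟨ ⊕-cancel-common y _ _ ⟩
    (x ⊕ e i) ⊕ (x ⊕ e j)                     ≡⟨ ⊕-cancel-common x _ _ ⟩
    e i ⊕ e j                                 ∎)
  where open ≡-Reasoning
... | inj₁ gᵣ≡eᵢ = inj₁ (begin
  y                        ≡⟨ ⊕-cancelʳ y (x ⊕ e i) ⟨
  (y ⊕ (x ⊕ e i)) ⊕ (x ⊕ e i)  ≡⟨ cong (_⊕ (x ⊕ e i)) (trans g≡gᵣ gᵣ≡eᵢ) ⟩
  e i ⊕ (x ⊕ e i)          ≡⟨ ⊕-comm (e i) _ ⟩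
  (x ⊕ e i) ⊕ e i          ≡⟨ ⊕-cancelʳ x (e i) ⟩
  x                        ∎)
  where open ≡-Reasoning
... | inj₂ gᵣ≡eⱼ = inj₂ (begin
  y                        ≡⟨ ⊕-cancelʳ y (x ⊕ e i) ⟨
  (y ⊕ (x ⊕ e i)) ⊕ (x ⊕ e i)  ≡⟨ cong (_⊕ (x ⊕ e i)) (trans g≡gᵣ gᵣ≡eⱼ) ⟩
  e j ⊕ (x ⊕ e i)          ≡⟨ ⊕-comm (e j) _ ⟩
  (x ⊕ e i) ⊕ e j          ∎)
  where open ≡-Reasoning

automorphism-injective : ∀ (φ : Automorphism n) {u v} → Automorphism.to φ u ≡ Automorphism.to φ v → u ≡ v
automorphism-injective φ {u} {v} eq =
  trans (sym (strictlyInverseʳ u)) (trans (cong from eq) (strictlyInverseʳ v))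
  where open Inverse (Automorphism.bij φ)

module _ (4≤n : 4 ≤ n) (φ : Automorphism n) (φ0≡0 : Automorphism.to φ 0ᵛ ≡ 0ᵛ)
         (φe≡e : ∀ k → Automorphism.to φ (e k) ≡ e k) where
  open Automorphism φ using (to; preserves)

  FixedWeight : ℕ → Set
  FixedWeight w = ∀ v → weight v ≡ w → to v ≡ v

  fixedWeight-step : ∀ {w} → FixedWeight w → FixedWeight (suc w) → FixedWeight (suc (suc w))
  fixedWeight-step {w} fixed-w fixed-w+1 v weight≡w+2
    with i , j , i≢j , vᵢ , vⱼ ← two-ones v weight≡w+2
    with common-neighbours 4≤n i≢j (φv~ vᵢ) (φv~ vⱼ)
    where
    φv~ : ∀ {k} → lookup v k ≡ true → FQAdj n (to v) (v ⊕ e k)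
    φv~ {k} vₖ = subst (FQAdj n (to v)) (fixed-w+1 _ (weight-⊕e-pred v k vₖ weight≡w+2))
                       (proj₁ (preserves v (v ⊕ e k)) (adjacent-⊕e v k))
  ... | inj₁ φv≡v              = φv≡v
  ... | inj₂ φv≡[v⊕eᵢ]⊕eⱼ      =
    contradiction (trans (sym weight≡w+2) (trans (cong weight v≡[v⊕eᵢ]⊕eⱼ) weight[v⊕eᵢ⊕eⱼ])) (ℕ.m+1+n≢n 1)
    where
    weight[v⊕eᵢ⊕eⱼ] : weight ((v ⊕ e i) ⊕ e j) ≡ w
    weight[v⊕eᵢ⊕eⱼ] = weight-⊕e-pred (v ⊕ e i) j (trans (lookup-⊕e-other v i≢j) vⱼ)
                                      (weight-⊕e-pred v i vᵢ weight≡w+2)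
    v≡[v⊕eᵢ]⊕eⱼ : v ≡ (v ⊕ e i) ⊕ e j
    v≡[v⊕eᵢ]⊕eⱼ = automorphism-injective φ (trans φv≡[v⊕eᵢ]⊕eⱼ (sym (fixed-w _ weight[v⊕eᵢ⊕eⱼ])))

  fixedWeight-0 : FixedWeight 0
  fixedWeight-0 v weight≡0 with refl ← weight≡0⇒0ᵛ v weight≡0 = φ0≡0

  fixedWeight-1 : FixedWeight 1
  fixedWeight-1 v weight≡1 with k , refl ← weight≡1⇒e v weight≡1 = φe≡e k

  fixedWeight : ∀ w → FixedWeight w × FixedWeight (suc w)
  fixedWeight zero    = fixedWeight-0 , fixedWeight-1
  fixedWeight (suc w) with fixed-w , fixed-w+1 ← fixedWeight w = fixed-w+1 , fixedWeight-step fixed-w fixed-w+1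

  fixes-all : ∀ v → to v ≡ v
  fixes-all v = proj₁ (fixedWeight (weight v)) v refl

-- Binary probes and the upper bound

2^suc : ∀ k → 2 ^ suc k ≡ 2 ^ k + 2 ^ k
2^suc k = cong (2 ^ k +_) (ℕ.+-identityʳ (2 ^ k))

≤2^-⌈log₂⌉ : ∀ k m → ⌈log₂ m ⌉ ≤ k → m ≤ 2 ^ k
≤2^-⌈log₂⌉ zero    zero          _   = z≤n
≤2^-⌈log₂⌉ zero    (suc zero)    _   = s≤s z≤n
≤2^-⌈log₂⌉ zero    (suc (suc m)) log≤0 =
  contradiction (ℕ.≤-trans (subst (_≤ ⌈log₂ suc (suc m) ⌉) (⌈log₂2^n⌉≡n 1) (⌈log₂⌉-mono-≤ {2} {suc (suc m)} (s≤s (s≤s z≤n)))) log≤0) λ ()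
≤2^-⌈log₂⌉ (suc k) m log≤1+k = begin
  m                     ≡⟨ ℕ.⌊n/2⌋+⌈n/2⌉≡n m ⟨
  ⌊ m /2⌋ + ⌈ m /2⌉     ≤⟨ ℕ.+-monoˡ-≤ ⌈ m /2⌉ (ℕ.⌊n/2⌋≤⌈n/2⌉ m) ⟩
  ⌈ m /2⌉ + ⌈ m /2⌉     ≤⟨ ℕ.+-mono-≤ half≤2^k half≤2^k ⟩
  2 ^ k + 2 ^ k         ≡⟨ 2^suc k ⟨
  2 ^ suc k             ∎
  where
  open ℕ.≤-Reasoning
  half≤2^k : ⌈ m /2⌉ ≤ 2 ^ k
  half≤2^k = ≤2^-⌈log₂⌉ k ⌈ m /2⌉ (subst (_≤ k) (sym (⌈log₂⌈n/2⌉⌉≡⌈log₂n⌉∸1 m)) (ℕ.∸-monoˡ-≤ 1 log≤1+k))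

odd : ℕ → Bool
odd zero          = false
odd (suc zero)    = true
odd (suc (suc x)) = odd x

bit : ℕ → ℕ → Bool
bit zero    x = odd x
bit (suc t) x = bit t ⌊ x /2⌋

bit-0 : ∀ t → bit t 0 ≡ false
bit-0 zero    = refl
bit-0 (suc t) = bit-0 t

odd-⌊/2⌋-injective : ∀ {x y} → odd x ≡ odd y → ⌊ x /2⌋ ≡ ⌊ y /2⌋ → x ≡ y
odd-⌊/2⌋-injective {zero}          {zero}          _ _ = refl
odd-⌊/2⌋-injective {suc zero}      {suc zero}      _ _ = refl
odd-⌊/2⌋-injective {suc (suc x)}   {suc (suc y)}   odd≡ half≡ =
  cong (2 +_) (odd-⌊/2⌋-injective {x} {y} odd≡ (ℕ.suc-injective half≡))
odd-⌊/2⌋-injective {zero}          {suc zero}      () _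
odd-⌊/2⌋-injective {suc zero}      {zero}          () _
odd-⌊/2⌋-injective {zero}          {suc (suc _)}   _ ()
odd-⌊/2⌋-injective {suc zero}      {suc (suc _)}   _ ()
odd-⌊/2⌋-injective {suc (suc _)}   {zero}          _ ()
odd-⌊/2⌋-injective {suc (suc _)}   {suc zero}      _ ()

⌊/2⌋-<-2^ : ∀ {x} k → x < 2 ^ suc k → ⌊ x /2⌋ < 2 ^ k
⌊/2⌋-<-2^ {x} k x<2^[1+k] = begin
  suc ⌊ x /2⌋                  ≤⟨ ℕ.⌊n/2⌋-mono (s≤s x<2^[1+k]) ⟩
  ⌈ 2 ^ suc k /2⌉              ≡⟨ cong ⌈_/2⌉ (2^suc k) ⟩
  ⌈ 2 ^ k + 2 ^ k /2⌉          ≡⟨ ℕ.n≡⌈n+n/2⌉ (2 ^ k) ⟨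
  2 ^ k                        ∎
  where open ℕ.≤-Reasoning

bits-separate : ∀ k {x y} → x < 2 ^ k → y < 2 ^ k → x ≢ y → ∃ λ t → t < k × bit t x ≢ bit t y
bits-separate zero {zero} {zero} _ _ x≢y = contradiction refl x≢y
bits-separate zero {suc _} (s≤s ())
bits-separate zero {zero} {suc _} _ (s≤s ())
bits-separate (suc k) {x} {y} x<2^[1+k] y<2^[1+k] x≢y with odd x 𝔹.≟ odd y
... | no  oddx≢oddy = zero , s≤s z≤n , oddx≢oddy
... | yes oddx≡oddy
  with t , t<k , bits≢ ← bits-separate k (⌊/2⌋-<-2^ k x<2^[1+k]) (⌊/2⌋-<-2^ k y<2^[1+k])
                                       (x≢y ∘ odd-⌊/2⌋-injective oddx≡oddy) =
  suc t , s≤s t<k , bits≢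

column : (ℕ → Bool) → Vertex n
column g = tabulate (g ∘ toℕ)

weight-∷ : ∀ b (v : Vertex n) → weight (b ∷ v) ≡ weight (b ∷ []) + weight v
weight-∷ true  v = refl
weight-∷ false v = refl

weight-column-⌊/2⌋ : ∀ n (g : ℕ → Bool) →
  weight (column {n} (g ∘ ⌊_/2⌋)) ≡ weight (column {⌈ n /2⌉} g) + weight (column {⌊ n /2⌋} g)
weight-column-⌊/2⌋ zero          g = refl
weight-column-⌊/2⌋ (suc zero)    g = sym (ℕ.+-identityʳ _)
weight-column-⌊/2⌋ (suc (suc n)) g = begin
  weight (g 0 ∷ g 0 ∷ column {n} (g ∘ suc ∘ ⌊_/2⌋))
    ≡⟨ trans (weight-∷ (g 0) (g 0 ∷ column {n} (g ∘ suc ∘ ⌊_/2⌋)))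
             (cong (g₀ +_) (weight-∷ (g 0) (column {n} (g ∘ suc ∘ ⌊_/2⌋)))) ⟩
  g₀ + (g₀ + weight (column {n} (g ∘ suc ∘ ⌊_/2⌋)))
    ≡⟨ cong (λ w → g₀ + (g₀ + w)) (weight-column-⌊/2⌋ n (g ∘ suc)) ⟩
  g₀ + (g₀ + (weight (column {⌈ n /2⌉} (g ∘ suc)) + weight (column {⌊ n /2⌋} (g ∘ suc))))
    ≡⟨ rearrange g₀ (weight (column {⌈ n /2⌉} (g ∘ suc))) (weight (column {⌊ n /2⌋} (g ∘ suc))) ⟩
  (g₀ + weight (column {⌈ n /2⌉} (g ∘ suc))) + (g₀ + weight (column {⌊ n /2⌋} (g ∘ suc)))
    ≡⟨ cong₂ _+_ (weight-∷ (g 0) (column {⌈ n /2⌉} (g ∘ suc))) (weight-∷ (g 0) (column {⌊ n /2⌋} (g ∘ suc))) ⟨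
  weight (column {suc ⌈ n /2⌉} g) + weight (column {suc ⌊ n /2⌋} g)
    ∎
  where
  open ≡-Reasoning
  g₀ = weight (g 0 ∷ [])
  rearrange : ∀ a b c → a + (a + (b + c)) ≡ (a + b) + (a + c)
  rearrange = solve-∀

weight-column-odd : ∀ n → weight (column {n} odd) ≡ ⌊ n /2⌋
weight-column-odd zero          = refl
weight-column-odd (suc zero)    = refl
weight-column-odd (suc (suc n)) = cong suc (weight-column-odd n)

column-bit-light : ∀ t → Light (column {n} (bit t))
column-bit-light {n} zero = begin
  weight (column {n} odd) + weight (column {n} odd)  ≡⟨ cong₂ _+_ (weight-column-odd n) (weight-column-odd n) ⟩
  ⌊ n /2⌋ + ⌊ n /2⌋                                  ≤⟨ ℕ.+-monoʳ-≤ ⌊ n /2⌋ (ℕ.⌊n/2⌋≤⌈n/2⌉ n) ⟩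
  ⌊ n /2⌋ + ⌈ n /2⌉                                  ≡⟨ ℕ.⌊n/2⌋+⌈n/2⌉≡n n ⟩
  n                                                  ∎
  where open ℕ.≤-Reasoning
column-bit-light {n} (suc t) = begin
  weight (column {n} (bit t ∘ ⌊_/2⌋)) + weight (column {n} (bit t ∘ ⌊_/2⌋))
    ≡⟨ cong₂ _+_ (weight-column-⌊/2⌋ n (bit t)) (weight-column-⌊/2⌋ n (bit t)) ⟩
  (c + f) + (c + f)      ≡⟨ ℕ-interchange c f c f ⟩
  (c + c) + (f + f)      ≤⟨ ℕ.+-mono-≤ (column-bit-light {⌈ n /2⌉} t) (column-bit-light {⌊ n /2⌋} t) ⟩
  ⌈ n /2⌉ + ⌊ n /2⌋      ≡⟨ ℕ.+-comm ⌈ n /2⌉ ⌊ n /2⌋ ⟩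
  ⌊ n /2⌋ + ⌈ n /2⌉      ≡⟨ ℕ.⌊n/2⌋+⌈n/2⌉≡n n ⟩
  n                      ∎
  where
  open ℕ.≤-Reasoning
  c = weight (column {⌈ n /2⌉} (bit t))
  f = weight (column {⌊ n /2⌋} (bit t))
  ℕ-interchange : ∀ a b c d → (a + b) + (c + d) ≡ (a + c) + (b + d)
  ℕ-interchange = solve-∀

lookup-column : ∀ (g : ℕ → Bool) (k : Fin n) → lookup (column g) k ≡ g (toℕ k)
lookup-column g = lookup∘tabulate (g ∘ toℕ)

-- Position 0 has only zero binary digits, whence the extra vertex e zero.
binaryDeterminingSet : ∀ n → ℕ → List (Vertex (suc n))
binaryDeterminingSet n b = 0ᵛ ∷ e zero ∷ applyUpTo (column ∘ bit) b

binaryDeterminingSet-isDetermining : ∀ {n b} → 4 ≤ suc n → suc n ≤ 2 ^ b →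
                                     IsDetermining (suc n) (binaryDeterminingSet n b)
binaryDeterminingSet-isDetermining {n} {b} 4≤n n≤2^b φ fixes =
  fixes-all 4≤n φ φ0≡0 (fixes-units φ φ0≡0 separating covering)
  where
  open Automorphism φ using (to)
  φ0≡0 : to 0ᵛ ≡ 0ᵛ
  φ0≡0 = fixes 0ᵛ (here refl)

  bitProbe : ∀ {t} → t < b → to (column (bit t)) ≡ column (bit t)
  bitProbe t<b = fixes _ (there (there (∈-applyUpTo⁺ (column ∘ bit) t<b)))

  <2^b : ∀ (k : Fin (suc n)) → toℕ k < 2 ^ b
  <2^b k = ℕ.<-≤-trans (toℕ<n k) n≤2^b

  separating : ∀ {k j} → k ≢ j → ∃ λ s → to s ≡ s × Light s × lookup s k ≢ lookup s j
  separating {k} {j} k≢j with t , t<b , bits≢ ← bits-separate b (<2^b k) (<2^b j) (k≢j ∘ toℕ-injective) =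
    column (bit t) , bitProbe t<b , column-bit-light t ,
    λ eq → bits≢ (trans (sym (lookup-column (bit t) k)) (trans eq (lookup-column (bit t) j)))

  covering : ∀ k → ∃ λ s → to s ≡ s × Light s × lookup s k ≡ true
  covering zero    = e zero , fixes (e zero) (there (here refl)) ,
                     subst (λ w → w + w ≤ suc n) (sym (weight-e {suc n} zero)) (ℕ.≤-trans (s≤s (s≤s z≤n)) 4≤n) ,
                     refl
  covering (suc k) with t , t<b , bits≢ ← bits-separate b (<2^b (suc k)) (<2^b zero) (λ ()) =
    column (bit t) , bitProbe t<b , column-bit-light t ,
    trans (lookup-column (bit t) (suc k)) (𝔹.¬-not (subst (bit t (suc (toℕ k)) ≢_) (bit-0 t) bits≢))

det-atMost : ∀ {k} (S : List (Vertex n)) → IsDetermining n S → length S ≤ k → DetAtMost n k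
det-atMost S determining |S|≤k =
  deduplicate _≟ᵛ_ S , UniqueDecProperties.deduplicate-! _≟ᵛ_ S ,
  (λ φ fixes → determining φ (λ x x∈S → fixes x (∈-deduplicate⁺ _≟ᵛ_ x∈S))) ,
  ℕ.≤-trans (length-deduplicate _≟ᵛ_ S) |S|≤k
  where _≟ᵛ_ = ≡-dec 𝔹._≟_

det-upperBound : 4 ≤ n → DetAtMost n (⌈log₂ n ⌉ + 2)
det-upperBound {suc n} 4≤n =
  det-atMost (binaryDeterminingSet n b)
    (binaryDeterminingSet-isDetermining 4≤n (≤2^-⌈log₂⌉ b (suc n) ℕ.≤-refl))
    (ℕ.≤-reflexive (trans (cong (2 +_) (length-applyUpTo (column ∘ bit) b)) (ℕ.+-comm 2 b)))
  where b = ⌈log₂ suc n ⌉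

proposition5p3 : (n : ℕ) → 4 ≤ n
    → DetAtLeast n (⌈log₂ (n + 1) ⌉ + 1) × DetAtMost n (⌈log₂ n ⌉ + 2)
proposition5p3 n 4≤n = det-lowerBound (ℕ.≤-trans (s≤s (s≤s z≤n)) 4≤n) , det-upperBound 4≤n
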